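{- Let $m,f,d$ be positive integers with $d<f$, let $r$ be an integer with $0 \le r \le m-1$ and $r \not\equiv f - r \pmod m$, and let $U$ be an $(m,f,d)$-admissible subset of $S(r)$ with signature $(i, j, I(r))$. Then \[ |E'(U, S(r))| = \begin{cases} j-1 & \text{if } i = I(r) \text{ and } 1 \le j \le I(r), \\ I(r) - i - 1 & \text{if } 0 \le i \le I(r)-1 \text{ and } j = 0, \\ I(r) - i + j - 2 & \text{if } I(r) > i \ge j > 0, \\ 0 & \text{if } i = I(r) \text{ and } j = 0. \end{cases} \]
   Context: For a finite set $S$ of positive integers, a subset $U \subseteq S$ is $(m,f,d)$-admissible if no two (not necessarily distinct) elements of $U$ sum to $f+m$, and whenever $x \in U$ and $x+m \in S$, also $x + m \in U$. For such $U$, $E'(U,S)$ is the set of $x \in U$ with $x + m \in U$. For $0 \le r \le m-1$, $S(r)$ is the set of integers in $[m,f]$ congruent to $r$ or to $f-r$ modulo $m$, and $I(r)$ is the number of integers in $[m,f]$ congruent to $r$ modulo $m$. When $r \not\equiv f-r \pmod m$, every admissible subset $U$ of $S(r)$ has the form $\{r+(i+1)m, r+(i+2)m, \ldots, r+I(r)m\} \cup \{f-r, f-r-m, \ldots, f-r-(j-1)m\}$ for unique integers $0 \le i, j \le I(r)$ (i.e. $i = I(r) - |\{x\in U: x\equiv r \bmod m\}|$ and $j = |\{x \in U : x \equiv f-r \bmod m\}|$); the triple $(i,j,I(r))$ is called the signature of $U$. -}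

module Defs where

open import Data.Nat using (ℕ; _+_; _≤_; _<_)
open import Data.Integer as ℤ using (ℤ; +_; _-_)
open import Data.Integer.Divisibility as ℤD using ()
open import Data.List using (List; length)
open import Data.List.Membership.Propositional using (_∈_)
open import Data.List.Relation.Unary.Unique.Propositional using (Unique)
open import Data.Product using (Σ; _×_)
open import Data.Sum using (_⊎_)
open import Function.Bundles using (_⇔_)
open import Relation.Binary.PropositionalEquality using (_≡_; _≢_)

ModEq : ℕ → ℤ → ℤ → Set
ModEq m a b = (+ m) ℤD.∣ (a - b)

Card : (ℕ → Set) → ℕ → Set
Card P n = Σ (List ℕ) λ L → Unique L × (∀ x → (x ∈ L) ⇔ P x) × (length L ≡ n)

S : ℕ → ℕ → ℕ → ℕ → Set
S m f r x = (m ≤ x) × (x ≤ f) × ((ModEq m (+ x) (+ r)) ⊎ (ModEq m (+ x) (+ f - + r)))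

Cls : ℕ → ℕ → ℕ → ℕ → Set
Cls m f r x = (m ≤ x) × (x ≤ f) × (ModEq m (+ x) (+ r))

-- U ⊆ S is (m,f,d)-admissible (d plays no role in the definition).
Admissible : ℕ → ℕ → ℕ → (S' : ℕ → Set) → (U : ℕ → Set) → Set
Admissible m f d S' U =
  (∀ x → U x → S' x) ×
  (∀ x y → U x → U y → x + y ≢ f + m) ×
  (∀ x → U x → S' (x + m) → U (x + m))

E' : ℕ → (U : ℕ → Set) → (S' : ℕ → Set) → ℕ → Set
E' m U S' x = U x × U (x + m)

Signature : ℕ → ℕ → ℕ → (U : ℕ → Set) → ℕ → ℕ → ℕ → Set
Signature m f r U i j I =
  Card (Cls m f r) I ×
  (Σ ℕ λ k → Card (λ x → U x × (ModEq m (+ x) (+ r))) k × (k + i ≡ I)) ×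
  Card (λ x → U x × (ModEq m (+ x) (+ f - + r))) j

-- Within one residue class c the elements of U form a ladder x, x + m, x + 2m, …
-- that, by the closure condition, reaches the top of [m, f]. Every rung except the
-- topmost one (the unique rung x with f < x + m) lies in E', so each nonempty class
-- contributes its size minus one. The classes of r and of f − r are distinct, hence
-- |E'| = (k − 1) + (j − 1) with k = I(r) − i, and the four cases are arithmetic.
module Submission where

open import Defs
open import Data.Nat using (ℕ; _+_; _∸_; _≤_; _<_; _≤?_; suc)
open import Data.Nat.Properties
  using (≤-total; ≤-antisym; ≤-<-trans; <-≤-trans; <⇒≱; ≰⇒>; +-assoc; +-suc;
         +-identityʳ; +-monoʳ-≤; +-monoˡ-≤; +-cancelˡ-<; m≤n+m; m+[n∸m]≡n;
         m+n∸n≡m; n∸n≡0; m∸n≡0⇒m≤n; m<n⇒0<n∸m)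
open import Data.Nat.Divisibility using (_∣_; >⇒∤)
open import Data.Integer as ℤ using (ℤ; +_; _-_)
open import Data.Integer.Properties using (m-n≡m⊖n; ∣⊖∣-≤)
import Data.Integer.Divisibility.Signed as Signed
open import Data.Integer.Solver using (module +-*-Solver)
open import Data.List using (List; []; _∷_; length; filter; _++_)
open import Data.List.Properties using (length-++)
open import Data.List.Membership.Propositional using (_∈_)
open import Data.List.Membership.Propositional.Properties
  using (∈-filter⁺; ∈-filter⁻; ∈-++⁻; ∈-++⁺ˡ; ∈-++⁺ʳ)
open import Data.List.Relation.Unary.Any using (here; there)
open import Data.List.Relation.Unary.AllPairs using (_∷_)
open import Data.List.Relation.Unary.All using (_∷_)
open import Data.List.Relation.Unary.Unique.Propositional using (Unique)
import Data.List.Relation.Unary.Unique.Propositional.Properties as Unique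
open import Data.Product using (Σ; _×_; _,_; proj₁; proj₂)
open import Data.Sum using (_⊎_; inj₁; inj₂)
open import Data.Empty using (⊥; ⊥-elim)
open import Function using (_∘_)
open import Function.Bundles using (_⇔_; mk⇔; Equivalence)
open import Relation.Nullary using (¬_; yes; no)
open import Relation.Unary using (Decidable; _∩_)
open import Relation.Unary.Properties using (∁?)
open import Relation.Binary.PropositionalEquality
  using (_≡_; refl; sym; trans; cong; subst; module ≡-Reasoning)

open +-*-Solver

module _ {m : ℕ} where

  ModEq-sym : ∀ a b → ModEq m a b → ModEq m b a
  ModEq-sym a b a≡b = Signed.∣⇒∣ᵤ (subst (Signed._∣_ (+ m)) negate
    (Signed.∣m⇒∣-m (Signed.∣ᵤ⇒∣ {i = a - b} a≡b)))
    where
    negate : ℤ.- (a - b) ≡ b - a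
    negate = solve 2 (λ A B → :- (A :- B) := B :- A) refl a b

  ModEq-trans : ∀ a b c → ModEq m a b → ModEq m b c → ModEq m a c
  ModEq-trans a b c a≡b b≡c = Signed.∣⇒∣ᵤ (subst (Signed._∣_ (+ m)) telescope
    (Signed.∣m∣n⇒∣m+n (Signed.∣ᵤ⇒∣ {i = a - b} a≡b) (Signed.∣ᵤ⇒∣ {i = b - c} b≡c)))
    where
    telescope : (a - b) ℤ.+ (b - c) ≡ a - c
    telescope = solve 3 (λ A B C → (A :- B) :+ (B :- C) := A :- C) refl a b c

  ModEq-+m : ∀ a b → ModEq m a b → ModEq m (a ℤ.+ + m) b
  ModEq-+m a b a≡b = Signed.∣⇒∣ᵤ (subst (Signed._∣_ (+ m)) shift
    (Signed.∣m∣n⇒∣m+n (Signed.∣ᵤ⇒∣ {i = a - b} a≡b) Signed.∣-refl))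
    where
    shift : (a - b) ℤ.+ + m ≡ (a ℤ.+ + m) - b
    shift = solve 3 (λ A B M → (A :- B) :+ M := (A :+ M) :- B) refl a b (+ m)

  ModEq⇒≡-within : ∀ {x y} → ModEq m (+ x) (+ y) → x ≤ y → y < x + m → x ≡ y
  ModEq⇒≡-within {x} {y} x≡y x≤y y<x+m with y ∸ x in gap
  ... | 0 = ≤-antisym x≤y (m∸n≡0⇒m≤n gap)
  ... | suc g = ⊥-elim (>⇒∤ gap<m m∣gap)
    where
    m∣gap : m ∣ suc g
    m∣gap = subst (m ∣_)
      (trans (cong ℤ.∣_∣ (m-n≡m⊖n x y)) (trans (∣⊖∣-≤ x≤y) gap)) x≡y
    gap<m : suc g < m
    gap<m = subst (_< m) gap
      (+-cancelˡ-< x (y ∸ x) m (subst (_< x + m) (sym (m+[n∸m]≡n x≤y)) y<x+m))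

module _ {A : Set} where

  length≡1 : ∀ {xs : List A} {x} → Unique xs → x ∈ xs →
             (∀ {y z} → y ∈ xs → z ∈ xs → y ≡ z) → length xs ≡ 1
  length≡1 {_ ∷ []} _ _ _ = refl
  length≡1 {_ ∷ _ ∷ _} ((x≢y ∷ _) ∷ _) _ allEqual =
    ⊥-elim (x≢y (allEqual (here refl) (there (here refl))))

  length-filter+length-filter-∁ : ∀ {P : A → Set} (P? : Decidable P) (xs : List A) →
    length (filter P? xs) + length (filter (∁? P?) xs) ≡ length xs
  length-filter+length-filter-∁ P? [] = refl
  length-filter+length-filter-∁ P? (x ∷ xs) with P? x
  ... | yes _ = cong suc (length-filter+length-filter-∁ P? xs)
  ... | no _ = trans (+-suc _ _) (cong suc (length-filter+length-filter-∁ P? xs))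

  length-filter-all-but-one : ∀ {P : A → Set} (P? : Decidable P) (xs : List A) →
    (∀ {x} → x ∈ xs → length (filter (∁? P?) xs) ≡ 1) →
    length (filter P? xs) ≡ length xs ∸ 1
  length-filter-all-but-one P? [] _ = refl
  length-filter-all-but-one P? xs@(_ ∷ _) one-outside = begin
    length (filter P? xs)                                    ≡⟨ m+n∸n≡m _ 1 ⟨
    length (filter P? xs) + 1 ∸ 1
      ≡⟨ cong (λ e → length (filter P? xs) + e ∸ 1) (one-outside (here refl)) ⟨
    length (filter P? xs) + length (filter (∁? P?) xs) ∸ 1
      ≡⟨ cong (_∸ 1) (length-filter+length-filter-∁ P? xs) ⟩
    length xs ∸ 1                                            ∎
    where open ≡-Reasoning

Card-cong : ∀ {P Q : ℕ → Set} {n} → (∀ x → P x ⇔ Q x) → Card P n → Card Q n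
Card-cong P⇔Q (xs , xs! , xs⇔P , len) =
  xs , xs! , (λ x → mk⇔ (to (P⇔Q x) ∘ to (xs⇔P x)) (from (xs⇔P x) ∘ from (P⇔Q x))) , len
  where open Equivalence

Card-split : ∀ {P A B : ℕ → Set} {a b} →
  (∀ x → P x → A x ⊎ B x) → (∀ x → A x → B x → ⊥) →
  Card (P ∩ A) a → Card (P ∩ B) b → Card P (a + b)
Card-split {P} split disjoint (xs , xs! , xs⇔PA , refl) (ys , ys! , ys⇔PB , refl) =
  xs ++ ys , Unique.++⁺ xs! ys! xs#ys , (λ x → mk⇔ (to′ x) (from′ x)) , length-++ xs
  where
  open Equivalence
  xs#ys : ∀ {v} → ¬ (v ∈ xs × v ∈ ys)
  xs#ys {v} (v∈xs , v∈ys) =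
    disjoint v (proj₂ (to (xs⇔PA v) v∈xs)) (proj₂ (to (ys⇔PB v) v∈ys))
  to′ : ∀ x → x ∈ xs ++ ys → P x
  to′ x x∈ with ∈-++⁻ xs x∈
  ... | inj₁ x∈xs = proj₁ (to (xs⇔PA x) x∈xs)
  ... | inj₂ x∈ys = proj₁ (to (ys⇔PB x) x∈ys)
  from′ : ∀ x → P x → x ∈ xs ++ ys
  from′ x Px with split x Px
  ... | inj₁ Ax = ∈-++⁺ˡ (from (xs⇔PA x) (Px , Ax))
  ... | inj₂ Bx = ∈-++⁺ʳ xs (from (ys⇔PB x) (Px , Bx))

Card-all-but-one : ∀ {P Q : ℕ → Set} (Q? : Decidable Q) {n} →
  (∀ {x} → P x → Σ ℕ λ y → P y × ¬ Q y) →
  (∀ {x y} → P x → ¬ Q x → P y → ¬ Q y → x ≡ y) →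
  Card P n → Card (P ∩ Q) (n ∸ 1)
Card-all-but-one {P} {Q} Q? exception exception-unique (xs , xs! , xs⇔P , refl) =
  filter Q? xs , Unique.filter⁺ Q? xs! , (λ x → mk⇔ (to′ x) (from′ x)) ,
  length-filter-all-but-one Q? xs exceptions≡1
  where
  open Equivalence
  to′ : ∀ x → x ∈ filter Q? xs → P x × Q x
  to′ x x∈ with ∈-filter⁻ Q? {xs = xs} x∈
  ... | x∈xs , Qx = to (xs⇔P x) x∈xs , Qx
  from′ : ∀ x → P x × Q x → x ∈ filter Q? xs
  from′ x (Px , Qx) = ∈-filter⁺ Q? (from (xs⇔P x) Px) Qx
  exceptions≡1 : ∀ {x} → x ∈ xs → length (filter (∁? Q?) xs) ≡ 1
  exceptions≡1 x∈xs with exception (to (xs⇔P _) x∈xs)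
  ... | y , Py , ¬Qy =
    length≡1 (Unique.filter⁺ (∁? Q?) xs!) (∈-filter⁺ (∁? Q?) (from (xs⇔P y) Py) ¬Qy) same
    where
    same : ∀ {u v} → u ∈ filter (∁? Q?) xs → v ∈ filter (∁? Q?) xs → u ≡ v
    same u∈ v∈ with ∈-filter⁻ (∁? Q?) {xs = xs} u∈ | ∈-filter⁻ (∁? Q?) {xs = xs} v∈
    ... | u∈xs , ¬Qu | v∈xs , ¬Qv =
      exception-unique (to (xs⇔P _) u∈xs) ¬Qu (to (xs⇔P _) v∈xs) ¬Qv

module Ladder (m f : ℕ) (m≥1 : 1 ≤ m) (c : ℤ) (U : ℕ → Set)
  (U≤f : ∀ {x} → U x → x ≤ f)
  (closed : ∀ {x} → U x → ModEq m (+ x) c → x + m ≤ f → U (x + m)) where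

  Rung : ℕ → Set
  Rung x = U x × ModEq m (+ x) c

  NonTopRung : ℕ → Set
  NonTopRung x = (U x × U (x + m)) × ModEq m (+ x) c

  -- n is fuel; the invariant f < x + n survives a step because m ≥ 1.
  climb : ∀ n {x} → f < x + n → Rung x → Σ ℕ λ y → Rung y × f < y + m
  climb 0 {x} f<x+0 (Ux , _) =
    ⊥-elim (<⇒≱ f<x+0 (subst (_≤ f) (sym (+-identityʳ x)) (U≤f Ux)))
  climb (suc n) {x} f<x+1+n rung@(Ux , x≡c) with x + m ≤? f
  ... | no x+m≰f = x , rung , ≰⇒> x+m≰f
  ... | yes x+m≤f = climb n f<x+m+n (closed Ux x≡c x+m≤f , ModEq-+m (+ x) c x≡c)
    where
    f<x+m+n : f < x + m + n
    f<x+m+n = <-≤-trans f<x+1+n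
      (subst (x + suc n ≤_) (sym (+-assoc x m n)) (+-monoʳ-≤ x (+-monoˡ-≤ n m≥1)))

  top-unique : ∀ {x y} → Rung x → f < x + m → Rung y → f < y + m → x ≡ y
  top-unique {x} {y} (Ux , x≡c) f<x+m (Uy , y≡c) f<y+m with ≤-total x y
  ... | inj₁ x≤y = ModEq⇒≡-within (ModEq-trans (+ x) c (+ y) x≡c (ModEq-sym (+ y) c y≡c))
                     x≤y (≤-<-trans (U≤f Uy) f<x+m)
  ... | inj₂ y≤x = sym (ModEq⇒≡-within (ModEq-trans (+ y) c (+ x) y≡c (ModEq-sym (+ x) c x≡c))
                          y≤x (≤-<-trans (U≤f Ux) f<y+m))

  Card-NonTopRung : ∀ {k} → Card Rung k → Card NonTopRung (k ∸ 1)
  Card-NonTopRung =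
    Card-cong stepping ∘ Card-all-but-one (λ x → x + m ≤? f) top top-unique′
    where
    top : ∀ {x} → Rung x → Σ ℕ λ y → Rung y × ¬ (y + m ≤ f)
    top {x} rung with climb (suc f) (m≤n+m (suc f) x) rung
    ... | y , rung′ , f<y+m = y , rung′ , <⇒≱ f<y+m
    top-unique′ : ∀ {x y} → Rung x → ¬ (x + m ≤ f) → Rung y → ¬ (y + m ≤ f) → x ≡ y
    top-unique′ rx x≰ ry y≰ = top-unique rx (≰⇒> x≰) ry (≰⇒> y≰)
    stepping : ∀ x → (Rung ∩ (λ y → y + m ≤ f)) x ⇔ NonTopRung x
    stepping x = mk⇔ (λ ((Ux , x≡c) , x+m≤f) → (Ux , closed Ux x≡c x+m≤f) , x≡c)
                     (λ ((Ux , Ux+m) , x≡c) → (Ux , x≡c) , U≤f Ux+m)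

pred+pred≡+∸2 : ∀ {a b} → 0 < a → 0 < b → (a ∸ 1) + (b ∸ 1) ≡ a + b ∸ 2
pred+pred≡+∸2 {suc a} {suc b} _ _ = sym (cong (_∸ 1) (+-suc a b))

lemma12 : (m f d r : ℕ) → 1 ≤ m → 1 ≤ d → d < f → r < m →
    ¬ (ModEq m (+ r) (+ f - + r)) →
    (U : ℕ → Set) → Admissible m f d (S m f r) U →
    (i j I : ℕ) → Signature m f r U i j I →
    ((i ≡ I → 1 ≤ j → j ≤ I → Card (E' m U (S m f r)) (j ∸ 1)) ×
    (i < I → j ≡ 0 → Card (E' m U (S m f r)) (I ∸ i ∸ 1)) ×
    (i < I → j ≤ i → 0 < j → Card (E' m U (S m f r)) ((I ∸ i) + j ∸ 2)) ×
    (i ≡ I → j ≡ 0 → Card (E' m U (S m f r)) 0))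
lemma12 m f d r m≥1 _ _ _ r≢f-r U (U⊆S , _ , closed) i j I
        (_ , (k , rungsʳ , k+i≡I) , rungsᶠ) =
  (λ { refl _ _ → subst (λ n → Card E'U (n ∸ 1 + (j ∸ 1))) (n∸n≡0 i) edges }) ,
  (λ { _ refl → subst (Card E'U) (+-identityʳ _) edges }) ,
  (λ i<I _ 0<j → subst (Card E'U) (pred+pred≡+∸2 (m<n⇒0<n∸m i<I) 0<j) edges) ,
  (λ { refl refl → subst (λ n → Card E'U (n ∸ 1 + 0)) (n∸n≡0 i) edges })
  where
  E'U : ℕ → Set
  E'U = E' m U (S m f r)
  U≤f : ∀ {x} → U x → x ≤ f
  U≤f {x} Ux = proj₁ (proj₂ (U⊆S x Ux))
  module Ladderʳ = Ladder m f m≥1 (+ r) U U≤f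
    (λ {x} Ux x≡r x+m≤f →
      closed x Ux (m≤n+m m x , x+m≤f , inj₁ (ModEq-+m (+ x) (+ r) x≡r)))
  module Ladderᶠ = Ladder m f m≥1 (+ f - + r) U U≤f
    (λ {x} Ux x≡f-r x+m≤f →
      closed x Ux (m≤n+m m x , x+m≤f , inj₂ (ModEq-+m (+ x) (+ f - + r) x≡f-r)))
  k≡I∸i : k ≡ I ∸ i
  k≡I∸i = trans (sym (m+n∸n≡m k i)) (cong (_∸ i) k+i≡I)
  edges : Card E'U ((I ∸ i ∸ 1) + (j ∸ 1))
  edges = Card-split (λ x (Ux , _) → proj₂ (proj₂ (U⊆S x Ux)))
    (λ x x≡r x≡f-r →
      r≢f-r (ModEq-trans (+ r) (+ x) (+ f - + r) (ModEq-sym (+ x) (+ r) x≡r) x≡f-r))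
    (subst (λ n → Card Ladderʳ.NonTopRung (n ∸ 1)) k≡I∸i (Ladderʳ.Card-NonTopRung rungsʳ))
    (Ladderᶠ.Card-NonTopRung rungsᶠ)
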